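{- For every integer $\alpha\geq 2$, $rb(\mathbb{Z}_{3^\alpha},3) > 3$.
   Context: $\mathbb{Z}_n$ denotes the cyclic group of order $n$. An $r$-coloring of $\mathbb{Z}_n$ is a surjective map $c:\mathbb{Z}_n\to\{1,\dots,r\}$. For a fixed integer $k$, a triple is any $(x_1,x_2,x_3)\in\mathbb{Z}_n^3$ with $x_1+x_2\equiv kx_3 \pmod n$. A triple is rainbow under $c$ if $c(x_1),c(x_2),c(x_3)$ are pairwise distinct; $c$ is rainbow-free if no triple is rainbow. The rainbow number $rb(\mathbb{Z}_n,k)$ is the smallest positive integer $r$ such that every $r$-coloring of $\mathbb{Z}_n$ admits a rainbow triple (by convention $rb(\mathbb{Z}_n,k)=n+1$ if no such $r$ exists). -}

module Defs where

open import Data.Nat using (ℕ; _≤_)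
open import Data.Integer as ℤ using (ℤ; +_)
open import Data.Integer.Divisibility using (_∣_)
open import Data.Fin using (Fin; toℕ)
open import Data.Product using (Σ; ∃; _×_)
open import Relation.Binary.PropositionalEquality using (_≡_; _≢_)
open import Relation.Nullary using (¬_)

-- Elements of ℤ_n are represented by Fin n (residues 0 … n-1).
-- An r-coloring uses colours Fin r (i.e. {1,…,r} shifted to {0,…,r-1}).
Coloring : ℕ → ℕ → Set
Coloring n r = Fin n → Fin r

IsSurjective : ∀ {n r} → Coloring n r → Set
IsSurjective {n} {r} c = ∀ (y : Fin r) → ∃ λ (x : Fin n) → c x ≡ y

IsTriple : (n : ℕ) (k : ℤ) → Fin n → Fin n → Fin n → Set
IsTriple n k x₁ x₂ x₃ =
  (+ n) ∣ ((+ toℕ x₁ ℤ.+ + toℕ x₂) ℤ.- (k ℤ.* + toℕ x₃))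

IsRainbow : ∀ {n r} → Coloring n r → Fin n → Fin n → Fin n → Set
IsRainbow c x₁ x₂ x₃ = (c x₁ ≢ c x₂) × (c x₁ ≢ c x₃) × (c x₂ ≢ c x₃)

HasRainbowTriple : (n : ℕ) (k : ℤ) {r : ℕ} → Coloring n r → Set
HasRainbowTriple n k c =
  Σ (Fin n) λ x₁ → Σ (Fin n) λ x₂ → Σ (Fin n) λ x₃ →
    IsTriple n k x₁ x₂ x₃ × IsRainbow c x₁ x₂ x₃

EveryColoringRainbow : (n : ℕ) (k : ℤ) (r : ℕ) → Set
EveryColoringRainbow n k r =
  (c : Coloring n r) → IsSurjective c → HasRainbowTriple n k c

-- Since rb(ℤ_n,k) is the least positive r with
-- EveryColoringRainbow n k r (or n+1 if none exists, which is consistent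
-- since the property holds vacuously for r > n), "rb > m" means exactly
-- that no positive r ≤ m has the property.
RbGreaterThan : (n : ℕ) (k : ℤ) (m : ℕ) → Set
RbGreaterThan n k m = ∀ (r : ℕ) → 1 ≤ r → r ≤ m → ¬ EveryColoringRainbow n k r

module Submission where

-- A surjective 3-colouring of ℤ_{3^α} without rainbow triples
-- for x₁ + x₂ ≡ 3x₃ shows rb(ℤ_{3^α}, 3) > 3.  We obtain it by reducing
-- modulo 9: colour x by the class of x mod 9 in the partition
--   {0,3,6} ∣ {1,2,7,8} ∣ {4,5},
-- which is rainbow-free on ℤ_9 (an exhaustive, decided check).
--
-- Since 9 ∣ 3^α and 9 ≤ 3^α for α ≥ 2, proposition5 follows.

open import Defs
open import Data.Nat using (ℕ; _≤_; _^_)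
open import Data.Integer using (+_)

open import Data.Nat.Base as ℕ using (suc; NonZero; _%_; _/_; _∸_; _≤′_; s≤s)
import Data.Nat.Properties as ℕ
import Data.Nat.Divisibility as ℕ
open import Data.Nat.DivMod using (_mod_; m≡m%n+[m/n]*n; m<n⇒m%n≡m)
open import Data.Integer.Base as ℤ using (ℤ)
open import Data.Integer.Properties using (pos-+; pos-*)
import Data.Integer.Divisibility.Signed as ℤ
open import Data.Integer.Tactic.RingSolver using (solve-∀)
open import Data.Fin.Base using (Fin; toℕ; inject≤; pinch)
open import Data.Fin.Patterns using (0F; 1F; 2F; 4F)
open import Data.Fin.Properties using (all?; toℕ-fromℕ<; toℕ-inject≤; toℕ-injective; toℕ<n; pinch-surjective)
  renaming (_≟_ to _≟F_)
open import Data.Product.Base using (_,_)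
open import Function.Base using (_∘_; id)
open import Relation.Nullary using (¬_; Dec)
open import Relation.Nullary.Decidable using (_×-dec_; _→-dec_; ¬?; toWitness)
open import Relation.Binary.PropositionalEquality using (_≡_; refl; sym; trans; cong; cong₂; subst; module ≡-Reasoning)

RainbowFree : (n : ℕ) (k : ℤ) {r : ℕ} → Coloring n r → Set
RainbowFree n k c = ∀ x₁ x₂ x₃ → IsTriple n k x₁ x₂ x₃ → ¬ IsRainbow c x₁ x₂ x₃

-- Colours that agree before a recolouring g still agree after it, so a
-- rainbow triple for g ∘ c is already rainbow for c.
recolour-rainbowFree : {n : ℕ} {k : ℤ} {r s : ℕ} (g : Fin s → Fin r) {c : Coloring n s} →
                       RainbowFree n k c → RainbowFree n k (g ∘ c)
recolour-rainbowFree g rf x₁ x₂ x₃ t (g₁₂ , g₁₃ , g₂₃) =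
  rf x₁ x₂ x₃ t (g₁₂ ∘ cong g , g₁₃ ∘ cong g , g₂₃ ∘ cong g)

recolour-surjective : {n r s : ℕ} {g : Fin s → Fin r} {c : Coloring n s} →
                      IsSurjective g → IsSurjective c → IsSurjective (g ∘ c)
recolour-surjective sg sc y with sg y
... | (z , gz≡y) with sc z
...   | (x , cx≡z) = x , trans (cong _ cx≡z) gz≡y

collapse : {r s : ℕ} → r ≤′ s → Fin (suc s) → Fin (suc r)
collapse ℕ.≤′-refl      = id
collapse (ℕ.≤′-step r≤s) = collapse r≤s ∘ pinch 0F

collapse-surjective : {r s : ℕ} (r≤s : r ≤′ s) → IsSurjective (collapse r≤s)
collapse-surjective ℕ.≤′-refl y = y , refl
collapse-surjective (ℕ.≤′-step r≤s) y with collapse-surjective r≤s y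
... | (z , z↦y) with pinch-surjective 0F z
...   | (x , x↦z) = x , trans (cong (collapse r≤s) (x↦z refl)) z↦y

-- One rainbow-free surjective s-colouring bounds the rainbow number:
-- collapsing it gives a rainbow-free surjective r-colouring for 1 ≤ r ≤ s.
rb>-from-rainbowFree : {n : ℕ} {k : ℤ} {s : ℕ} (c : Coloring n s) →
                       IsSurjective c → RainbowFree n k c → RbGreaterThan n k s
rb>-from-rainbowFree c sc rf 0 () _ _
rb>-from-rainbowFree {n} {k} c sc rf (suc r) _ (s≤s r≤s) every =
  no-rainbow (every (g ∘ c) (recolour-surjective (collapse-surjective r≤′s) sc))
  where
  r≤′s : r ≤′ _
  r≤′s = ℕ.≤⇒≤′ r≤s
  g : Fin _ → Fin (suc r)
  g = collapse r≤′s
  no-rainbow : ¬ HasRainbowTriple n k (g ∘ c)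
  no-rainbow (x₁ , x₂ , x₃ , t , rainbow) = recolour-rainbowFree {n} {k} g rf x₁ x₂ x₃ t rainbow

residue : {n : ℕ} (m : ℕ) .{{_ : NonZero m}} → Fin n → Fin m
residue m x = toℕ x mod m

toℕ-residue : {n : ℕ} (m : ℕ) .{{_ : NonZero m}} (x : Fin n) → toℕ (residue m x) ≡ toℕ x % m
toℕ-residue m x = toℕ-fromℕ< _

-- Residues below m are fixed, so reduction is onto when m ≤ n.
residue-inject≤ : {n m : ℕ} .{{_ : NonZero m}} (m≤n : m ≤ n) (x : Fin m) →
                  residue m (inject≤ x m≤n) ≡ x
residue-inject≤ {m = m} m≤n x = toℕ-injective (begin
  toℕ (residue m (inject≤ x m≤n)) ≡⟨ toℕ-residue m (inject≤ x m≤n) ⟩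
  toℕ (inject≤ x m≤n) % m         ≡⟨ cong (_% m) (toℕ-inject≤ x m≤n) ⟩
  toℕ x % m                       ≡⟨ m<n⇒m%n≡m (toℕ<n x) ⟩
  toℕ x                           ∎)
  where open ≡-Reasoning

division-ℤ : (a m : ℕ) .{{_ : NonZero m}} → + a ≡ + (a % m) ℤ.+ + (a / m) ℤ.* + m
division-ℤ a m = begin
  + a                               ≡⟨ cong +_ (m≡m%n+[m/n]*n a m) ⟩
  + (a % m ℕ.+ a / m ℕ.* m)         ≡⟨ pos-+ (a % m) (a / m ℕ.* m) ⟩
  + (a % m) ℤ.+ + (a / m ℕ.* m)     ≡⟨ cong (ℤ._+_ (+ (a % m))) (pos-* (a / m) m) ⟩
  + (a % m) ℤ.+ + (a / m) ℤ.* + m   ∎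
  where open ≡-Reasoning

linear-shift : ∀ a₁ a₂ a₃ q₁ q₂ q₃ k m →
  ((a₁ ℤ.+ q₁ ℤ.* m) ℤ.+ (a₂ ℤ.+ q₂ ℤ.* m)) ℤ.- k ℤ.* (a₃ ℤ.+ q₃ ℤ.* m)
    ≡ ((a₁ ℤ.+ a₂) ℤ.- k ℤ.* a₃) ℤ.+ (q₁ ℤ.+ q₂ ℤ.- k ℤ.* q₃) ℤ.* m
linear-shift = solve-∀

residue-triple : {n m : ℕ} .{{_ : NonZero m}} {k : ℤ} → m ℕ.∣ n →
                 ∀ x₁ x₂ x₃ → IsTriple n k x₁ x₂ x₃ →
                 IsTriple m k (residue m x₁) (residue m x₂) (residue m x₃)
residue-triple {n} {m} {k} m∣n x₁ x₂ x₃ t =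
  subst (λ d → m ℕ.∣ ℤ.∣ d ∣) (sym reduced≡) (ℤ.∣⇒∣ᵤ m∣reduced)
  where
  a₁ a₂ a₃ : ℕ
  a₁ = toℕ x₁
  a₂ = toℕ x₂
  a₃ = toℕ x₃
  reduced : ℤ
  reduced = (+ (a₁ % m) ℤ.+ + (a₂ % m)) ℤ.- k ℤ.* + (a₃ % m)
  reduced≡ : (+ toℕ (residue m x₁) ℤ.+ + toℕ (residue m x₂)) ℤ.- k ℤ.* + toℕ (residue m x₃) ≡ reduced
  reduced≡ = cong₂ (λ u v → u ℤ.- k ℤ.* v)
    (cong₂ (λ u v → + u ℤ.+ + v) (toℕ-residue m x₁) (toℕ-residue m x₂))
    (cong +_ (toℕ-residue m x₃))
  quot : ℤ
  quot = + (a₁ / m) ℤ.+ + (a₂ / m) ℤ.- k ℤ.* + (a₃ / m)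
  original≡ : (+ a₁ ℤ.+ + a₂) ℤ.- k ℤ.* + a₃ ≡ reduced ℤ.+ quot ℤ.* + m
  original≡ = begin
    (+ a₁ ℤ.+ + a₂) ℤ.- k ℤ.* + a₃
      ≡⟨ cong₂ (λ u v → u ℤ.- k ℤ.* v) (cong₂ ℤ._+_ (division-ℤ a₁ m) (division-ℤ a₂ m)) (division-ℤ a₃ m) ⟩
    _ ≡⟨ linear-shift (+ (a₁ % m)) (+ (a₂ % m)) (+ (a₃ % m)) (+ (a₁ / m)) (+ (a₂ / m)) (+ (a₃ / m)) k (+ m) ⟩
    reduced ℤ.+ quot ℤ.* + m ∎
    where open ≡-Reasoning
  m∣original : + m ℤ.∣ reduced ℤ.+ quot ℤ.* + m
  m∣original = subst (+ m ℤ.∣_) original≡ (ℤ.∣ᵤ⇒∣ (ℕ.∣-trans m∣n t))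
  m∣reduced : + m ℤ.∣ reduced
  m∣reduced = ℤ.∣m+n∣n⇒∣m m∣original (ℤ.∣n⇒∣m*n quot ℤ.∣-refl)

pullback-rainbowFree : {n m : ℕ} .{{_ : NonZero m}} {k : ℤ} {r : ℕ} {p : Coloring m r} →
                       m ℕ.∣ n → RainbowFree m k p → RainbowFree n k (p ∘ residue m)
pullback-rainbowFree {k = k} m∣n rf x₁ x₂ x₃ t =
  rf (residue _ x₁) (residue _ x₂) (residue _ x₃) (residue-triple {k = k} m∣n x₁ x₂ x₃ t)

pullback-surjective : {n m : ℕ} .{{_ : NonZero m}} {r : ℕ} {p : Coloring m r} →
                      m ≤ n → IsSurjective p → IsSurjective (p ∘ residue {n} m)
pullback-surjective {p = p} m≤n sp y with sp y
... | (x , px≡y) = inject≤ x m≤n , trans (cong p (residue-inject≤ m≤n x)) px≡y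

colour₉ : Coloring 9 3
colour₉ x with toℕ x
... | 0 = 0F
... | 1 = 1F
... | 2 = 1F
... | 3 = 0F
... | 4 = 2F
... | 5 = 2F
... | 6 = 0F
... | 7 = 1F
... | _ = 1F

colour₉-surjective : IsSurjective colour₉
colour₉-surjective 0F = 0F , refl
colour₉-surjective 1F = 1F , refl
colour₉-surjective 2F = 4F , refl

rainbowFree? : (n : ℕ) (k : ℤ) {r : ℕ} (c : Coloring n r) → Dec (RainbowFree n k c)
rainbowFree? n k c = all? λ x₁ → all? λ x₂ → all? λ x₃ →
  (n ℕ.∣? ℤ.∣ (+ toℕ x₁ ℤ.+ + toℕ x₂) ℤ.- k ℤ.* + toℕ x₃ ∣) →-dec
  ¬? (¬? (c x₁ ≟F c x₂) ×-dec ¬? (c x₁ ≟F c x₃) ×-dec ¬? (c x₂ ≟F c x₃))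

-- Checked exhaustively over all 9³ triples.  (By hand: x₁ + x₂ ≡ 3x₃ forces
-- 3 ∣ x₁ + x₂, so either x₁, x₂ both lie in {0,3,6}, or {x₁, x₂} mod 3 is
-- {1, 2}; differently coloured such x₁, x₂ have 9 ∤ x₁ + x₂, so x₃ is not a
-- multiple of 3 and repeats one of their colours.)
colour₉-rainbowFree : RainbowFree 9 (+ 3) colour₉
colour₉-rainbowFree = toWitness {a? = rainbowFree? 9 (+ 3) colour₉} _

^-monoʳ-∣ : (a : ℕ) {i j : ℕ} → i ≤ j → a ^ i ℕ.∣ a ^ j
^-monoʳ-∣ a {i} {j} i≤j = subst (a ^ i ℕ.∣_) a^i*a^[j∸i]≡a^j (ℕ.m∣m*n (a ^ (j ∸ i)))
  where
  a^i*a^[j∸i]≡a^j : a ^ i ℕ.* a ^ (j ∸ i) ≡ a ^ j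
  a^i*a^[j∸i]≡a^j = trans (sym (ℕ.^-distribˡ-+-* a i (j ∸ i))) (cong (a ^_) (ℕ.m+[n∸m]≡n i≤j))

proposition5 : (α : ℕ) → 2 ≤ α → RbGreaterThan (3 ^ α) (+ 3) 3
proposition5 α 2≤α =
  rb>-from-rainbowFree {k = + 3} (colour₉ ∘ residue 9)
    (pullback-surjective (ℕ.^-monoʳ-≤ 3 2≤α) colour₉-surjective)
    (pullback-rainbowFree {k = + 3} (^-monoʳ-∣ 3 2≤α) colour₉-rainbowFree)
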